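{- For any biaffine plane $B_q$ of order $q$, we have $\mu(B_q)\geq 2q-2$.
   Context: A biaffine plane of order $q$ is obtained from an affine plane of order $q$ by deleting all lines of one parallel class (keeping all points). $\mu(B_q)$ denotes the metric dimension of its incidence graph (bipartite graph on points and lines, adjacency = incidence): the minimum size of a vertex set $S$ such that every two distinct vertices $u\neq v$ have some $s\in S$ with $d(u,s)\neq d(v,s)$. -}

module Defs where

open import Data.Nat using (ℕ; zero; suc; _<_)
open import Data.Bool using (Bool; true)
open import Data.Fin using (Fin)
open import Data.Empty using (⊥)
open import Data.Product using (Σ; ∃; _×_; proj₁)
open import Data.Sum using (_⊎_; inj₁; inj₂)
open import Data.List using (List)
open import Data.List.Relation.Unary.Any using (Any)
open import Relation.Nullary using (¬_)
open import Relation.Binary.PropositionalEquality using (_≡_; _≢_)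
open import Function.Bundles using (_↔_)

module _ {V : Set} (Adj : V → V → Set) where

  data Walk : V → V → ℕ → Set where
    here : ∀ {u} → Walk u u zero
    step : ∀ {u w v n} → Adj u w → Walk w v n → Walk u v (suc n)

  IsDist : V → V → ℕ → Set
  IsDist u v n = Walk u v n × (∀ m → m < n → ¬ Walk u v m)

  -- d(u,s) ≠ d(v,s)  (distances in ℕ ∪ {∞})
  DistDiffer : V → V → V → Set
  DistDiffer s u v =
    (∃ λ n → IsDist u s n × ¬ IsDist v s n) ⊎
    (∃ λ n → IsDist v s n × ¬ IsDist u s n)

  Resolving : List V → Set
  Resolving S = ∀ u v → u ≢ v → Any (λ s → DistDiffer s u v) S

record AffinePlane (q : ℕ) : Set₁ where
  field
    Point : Set
    Line  : Set
    inc   : Point → Line → Bool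

  On : Point → Line → Set
  On p l = inc p l ≡ true

  Disjoint : Line → Line → Set
  Disjoint l m = ∀ p → ¬ (On p l × On p m)

  Parallel : Line → Line → Set
  Parallel l m = (l ≡ m) ⊎ Disjoint l m

  field
    join     : ∀ p p' → p ≢ p' → ∃ λ l → On p l × On p' l
    join-uniq : ∀ p p' → p ≢ p' → ∀ l l' →
                On p l → On p' l → On p l' → On p' l' → l ≡ l'
    playfair      : ∀ p l → ¬ On p l → ∃ λ m → On p m × Disjoint m l
    playfair-uniq : ∀ p l → ¬ On p l → ∀ m m' →
                    On p m → Disjoint m l → On p m' → Disjoint m' l → m ≡ m'
    noncollinear : ∃ λ a → ∃ λ b → ∃ λ c →
                   ¬ (∃ λ l → On a l × On b l × On c l)
    order : ∀ l → Fin q ↔ Σ Point (λ p → On p l)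

module Biaffine {q : ℕ} (A : AffinePlane q) (ℓ₀ : AffinePlane.Line A) where
  open AffinePlane A

  BLine : Set
  BLine = Σ Line (λ m → ¬ Parallel m ℓ₀)

  Vertex : Set
  Vertex = Point ⊎ BLine

  Adj : Vertex → Vertex → Set
  Adj (inj₁ p) (inj₂ l) = On p (proj₁ l)
  Adj (inj₂ l) (inj₁ p) = On p (proj₁ l)
  Adj (inj₁ _) (inj₁ _) = ⊥
  Adj (inj₂ _) (inj₂ _) = ⊥

  IsResolving : List Vertex → Set
  IsResolving = Resolving Adj

-- In the incidence graph, two points on a common vertical line, and two disjoint lines of the
-- biaffine plane, are twins: every vertex outside their closed neighbourhoods is at the same
-- distance from both. Hence a resolving set S must, for every two points of a vertical line,
-- contain a vertex equal or adjacent to one of them. A line of S meets a vertical line at most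
-- once, so each of the q vertical lines through the points of a fixed line contains at least
-- q − 1 − b points of S, where b is the number of lines in S. Dually, for each of the q lines
-- joining a point o off ℓ₀ to the points of ℓ₀, at least q − 1 − a lines of S are parallel to
-- it, where a is the number of points in S. The inequalities q(q − 1 − b) ≤ a and
-- q(q − 1 − a) ≤ b together force a + b ≥ 2q − 2.
module Submission where

import Data.Nat.Properties as ℕ
open import Algebra.Properties.CommutativeSemigroup ℕ.+-commutativeSemigroup using (interchange)
open import Algebra.Properties.CommutativeMonoid.Sum ℕ.+-0-commutativeMonoid
  using (sum-syntax; ∑-distrib-+; sum-replicate-zero)
open import Axiom.UniquenessOfIdentityProofs using (module Decidable⇒UIP)
open import Data.Bool using (Bool; true; false; not; _xor_; if_then_else_)
import Data.Bool.Properties as Bool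
open import Data.Empty using (⊥; ⊥-elim)
open import Data.Fin using (Fin; zero; suc; _≟_)
import Data.Fin.Properties as Fin
open import Data.List using (List; []; _∷_; length)
open import Data.List.Relation.Unary.Any using (Any)
import Data.List.Relation.Unary.Any as Any
open import Data.List.Relation.Unary.Any.Properties using (Any-⊎⁻)
open import Data.List.Relation.Unary.Unique.Propositional using (Unique)
open import Data.Nat
  using (ℕ; zero; suc; _+_; _*_; _∸_; _≤_; _<_; z≤n; s≤s; _≤?_; NonZero; >-nonZero)
open import Data.Nat.Properties
  using (≤-refl; ≤-reflexive; ≤-trans; <⇒≤; ≰⇒>; +-comm; +-assoc; +-identityʳ; +-suc;
         *-identityʳ; +-mono-≤; +-monoˡ-≤; +-monoʳ-≤; m≤m*n; m∸n+n≡m; m≤n+o⇒m∸n≤o; m<n⇒0<n∸m;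
         module ≤-Reasoning)
open import Data.Product using (Σ; Σ-syntax; ∃; _×_; _,_; proj₁; proj₂)
open import Data.Sum using (_⊎_; inj₁; inj₂; swap; [_,_]′)
open import Data.Sum.Properties using (inj₁-injective; inj₂-injective)
open import Data.Unit using (⊤; tt)
open import Function using (_∘_)
open import Function.Bundles using (Inverse)
open import Relation.Binary using (DecidableEquality)
open import Relation.Binary.PropositionalEquality
  using (_≡_; _≢_; refl; sym; trans; cong; subst; ≢-sym; module ≡-Reasoning)
open import Relation.Nullary
  using (¬_; Dec; yes; no; does; ¬?; _×-dec_; _⊎-dec_; contradiction)
import Relation.Nullary.Decidable as Dec
open import Relation.Unary using (Decidable)

open import Defs

𝟙 : {A : Set} → Dec A → ℕ
𝟙 a? = if does a? then 1 else 0

𝟙≤1 : {A : Set} (a? : Dec A) → 𝟙 a? ≤ 1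
𝟙≤1 (yes _) = ≤-refl
𝟙≤1 (no _)  = z≤n

𝟙+𝟙-¬ : {A : Set} (a? : Dec A) → 𝟙 a? + 𝟙 (¬? a?) ≡ 1
𝟙+𝟙-¬ (yes _) = refl
𝟙+𝟙-¬ (no _)  = refl

module _ {A B : Set} where

  𝟙-mono : (A → B) → (a? : Dec A) (b? : Dec B) → 𝟙 a? ≤ 𝟙 b?
  𝟙-mono _ (yes _) (yes _) = ≤-refl
  𝟙-mono f (yes a) (no ¬b) = ⊥-elim (¬b (f a))
  𝟙-mono _ (no _)  _       = z≤n

  𝟙-⊎ : (a? : Dec A) (b? : Dec B) → 𝟙 (a? ⊎-dec b?) ≤ 𝟙 a? + 𝟙 b?
  𝟙-⊎ (yes _) _ = s≤s z≤n
  𝟙-⊎ (no _)  _ = ≤-refl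

  𝟙+𝟙≤1 : ¬ (A × B) → (a? : Dec A) (b? : Dec B) → 𝟙 a? + 𝟙 b? ≤ 1
  𝟙+𝟙≤1 _    (no _)  (no _)  = z≤n
  𝟙+𝟙≤1 _    (no _)  (yes _) = ≤-refl
  𝟙+𝟙≤1 _    (yes _) (no _)  = ≤-refl
  𝟙+𝟙≤1 ¬a×b (yes a) (yes b) = ⊥-elim (¬a×b (a , b))

module _ {X : Set} where

  count : {P : X → Set} → Decidable P → List X → ℕ
  count P? []       = 0
  count P? (x ∷ xs) = 𝟙 (P? x) + count P? xs

  𝟙-any≤count : {P : X → Set} (P? : Decidable P) → ∀ xs → 𝟙 (Any.any? P? xs) ≤ count P? xs
  𝟙-any≤count P? []       = z≤n
  𝟙-any≤count P? (x ∷ xs) =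
    ≤-trans (𝟙-⊎ (P? x) (Any.any? P? xs)) (+-monoʳ-≤ (𝟙 (P? x)) (𝟙-any≤count P? xs))

  module _ {P Q : X → Set} (P? : Decidable P) (Q? : Decidable Q) where

    count-mono : (∀ x → P x → Q x) → ∀ xs → count P? xs ≤ count Q? xs
    count-mono P⊆Q []       = z≤n
    count-mono P⊆Q (x ∷ xs) = +-mono-≤ (𝟙-mono (P⊆Q x) (P? x) (Q? x)) (count-mono P⊆Q xs)

    count-⊎ : ∀ xs → count (λ x → P? x ⊎-dec Q? x) xs ≤ count P? xs + count Q? xs
    count-⊎ []       = z≤n
    count-⊎ (x ∷ xs) = begin
      𝟙 (P? x ⊎-dec Q? x) + count (λ x → P? x ⊎-dec Q? x) xs
        ≤⟨ +-mono-≤ (𝟙-⊎ (P? x) (Q? x)) (count-⊎ xs) ⟩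
      (𝟙 (P? x) + 𝟙 (Q? x)) + (count P? xs + count Q? xs)
        ≡⟨ interchange (𝟙 (P? x)) (𝟙 (Q? x)) (count P? xs) (count Q? xs) ⟩
      count P? (x ∷ xs) + count Q? (x ∷ xs)
        ∎
      where open ≤-Reasoning

    count+count≤length : (∀ x → ¬ (P x × Q x)) → ∀ xs → count P? xs + count Q? xs ≤ length xs
    count+count≤length disjoint []       = z≤n
    count+count≤length disjoint (x ∷ xs) = begin
      count P? (x ∷ xs) + count Q? (x ∷ xs)
        ≡⟨ interchange (𝟙 (P? x)) (count P? xs) (𝟙 (Q? x)) (count Q? xs) ⟩
      (𝟙 (P? x) + 𝟙 (Q? x)) + (count P? xs + count Q? xs)
        ≤⟨ +-mono-≤ (𝟙+𝟙≤1 (disjoint x) (P? x) (Q? x)) (count+count≤length disjoint xs) ⟩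
      suc (length xs)
        ∎
      where open ≤-Reasoning

∑-mono-≤ : ∀ {n} {f g : Fin n → ℕ} → (∀ i → f i ≤ g i) → ∑[ i < n ] f i ≤ ∑[ i < n ] g i
∑-mono-≤ {zero}  f≤g = z≤n
∑-mono-≤ {suc n} f≤g = +-mono-≤ (f≤g zero) (∑-mono-≤ (f≤g ∘ suc))

*≤∑ : ∀ {n c} {f : Fin n → ℕ} → (∀ i → c ≤ f i) → n * c ≤ ∑[ i < n ] f i
*≤∑ {zero}  c≤f = z≤n
*≤∑ {suc n} c≤f = +-mono-≤ (c≤f zero) (*≤∑ (c≤f ∘ suc))

∑-𝟙≤𝟙-any : ∀ {n} {P : Fin n → Set} (P? : Decidable P) → (∀ i j → P i → P j → i ≡ j) →
            ∑[ i < n ] 𝟙 (P? i) ≤ 𝟙 (Fin.any? P?)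
∑-𝟙≤𝟙-any {zero}  P? unique = z≤n
∑-𝟙≤𝟙-any {suc n} P? unique
  with P? zero | Fin.any? (P? ∘ suc)
     | ∑-𝟙≤𝟙-any (P? ∘ suc) (λ i j Pi Pj → Fin.suc-injective (unique (suc i) (suc j) Pi Pj))
... | no _   | _            | tail-bound = tail-bound
... | yes _  | no _         | tail-bound = +-monoʳ-≤ 1 tail-bound
... | yes P₀ | yes (i , Pi) | _ with () ← unique zero (suc i) P₀ Pi

∑-count≤count : ∀ {X : Set} {m} {P : Fin m → X → Set} {Q : X → Set}
                (P? : ∀ i → Decidable (P i)) (Q? : Decidable Q) →
                (∀ x i j → P i x → P j x → i ≡ j) → (∀ i x → P i x → Q x) →
                ∀ xs → ∑[ i < m ] count (P? i) xs ≤ count Q? xs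
∑-count≤count {m = m} P? Q? unique P⊆Q []       = ≤-reflexive (sum-replicate-zero m)
∑-count≤count {m = m} P? Q? unique P⊆Q (x ∷ xs) = begin
  ∑[ i < m ] (𝟙 (P? i x) + count (P? i) xs)
    ≡⟨ ∑-distrib-+ (λ i → 𝟙 (P? i x)) (λ i → count (P? i) xs) ⟩
  ∑[ i < m ] 𝟙 (P? i x) + ∑[ i < m ] count (P? i) xs
    ≤⟨ +-mono-≤ head-bound (∑-count≤count P? Q? unique P⊆Q xs) ⟩
  𝟙 (Q? x) + count Q? xs
    ∎
  where
  open ≤-Reasoning
  head-bound : ∑[ i < m ] 𝟙 (P? i x) ≤ 𝟙 (Q? x)
  head-bound = ≤-trans (∑-𝟙≤𝟙-any (λ i → P? i x) (unique x))
                       (𝟙-mono (λ (i , Pix) → P⊆Q i x Pix) (Fin.any? (λ i → P? i x)) (Q? x))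

module _ {X : Set} {n : ℕ} {Covers : X → Fin n → Set} (covers? : ∀ s → Decidable (Covers s)) where

  pairwise-covered⇒≤1+coverers :
    (∀ s i j → Covers s i → Covers s j → i ≡ j) →
    ∀ S → (∀ i j → i ≢ j → Any (λ s → Covers s i ⊎ Covers s j) S) →
    n ≤ suc (count (λ s → Fin.any? (covers? s)) S)
  pairwise-covered⇒≤1+coverers covers-one S covers-pairs = begin
    n                                                             ≡⟨ *-identityʳ n ⟨
    n * 1                                                         ≤⟨ *≤∑ covered-or-not ⟩
    ∑[ i < n ] (𝟙 (covered? i) + 𝟙 (¬? (covered? i)))
      ≡⟨ ∑-distrib-+ (λ i → 𝟙 (covered? i)) (λ i → 𝟙 (¬? (covered? i))) ⟩
    ∑[ i < n ] 𝟙 (covered? i) + ∑[ i < n ] 𝟙 (¬? (covered? i))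
      ≤⟨ +-mono-≤ covered-bound uncovered-bound ⟩
    coverers + 1                                                  ≡⟨ +-comm coverers 1 ⟩
    suc coverers                                                  ∎
    where
    open ≤-Reasoning
    coverers : ℕ
    coverers = count (λ s → Fin.any? (covers? s)) S

    covered? : ∀ i → Dec (Any (λ s → Covers s i) S)
    covered? i = Any.any? (λ s → covers? s i) S

    covered-or-not : ∀ i → 1 ≤ 𝟙 (covered? i) + 𝟙 (¬? (covered? i))
    covered-or-not i = ≤-reflexive (sym (𝟙+𝟙-¬ (covered? i)))

    covered-bound : ∑[ i < n ] 𝟙 (covered? i) ≤ coverers
    covered-bound = ≤-trans (∑-mono-≤ (λ i → 𝟙-any≤count (λ s → covers? s i) S))
                            (∑-count≤count (λ i s → covers? s i) (λ s → Fin.any? (covers? s))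
                                           covers-one (λ i s c → i , c) S)

    uncovered-unique : ∀ i j → ¬ Any (λ s → Covers s i) S → ¬ Any (λ s → Covers s j) S → i ≡ j
    uncovered-unique i j ¬cov-i ¬cov-j with i ≟ j
    ... | yes i≡j = i≡j
    ... | no i≢j  = ⊥-elim ([ ¬cov-i , ¬cov-j ]′ (Any-⊎⁻ (covers-pairs i j i≢j)))

    uncovered-bound : ∑[ i < n ] 𝟙 (¬? (covered? i)) ≤ 1
    uncovered-bound = ≤-trans (∑-𝟙≤𝟙-any (λ i → ¬? (covered? i)) uncovered-unique)
                              (𝟙≤1 (Fin.any? (λ i → ¬? (covered? i))))

module _ {X : Set} {m n : ℕ} {Same Other : X → Set} (same? : Decidable Same) (other? : Decidable Other)
         (same-or-other : ∀ s → Same s ⊎ Other s)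
         {Covers : X → Fin m → Fin n → Set} (covers? : ∀ s k → Decidable (Covers s k)) where

  blocks-covered⇒bound :
    (∀ s k j j' → Covers s k j → Covers s k j' → j ≡ j') →
    (∀ s k k' j j' → Same s → Covers s k j → Covers s k' j' → k ≡ k') →
    ∀ S → (∀ k j j' → j ≢ j' → Any (λ s → Covers s k j ⊎ Covers s k j') S) →
    m * (n ∸ 1 ∸ count other? S) ≤ count same? S
  blocks-covered⇒bound covers-one same-one-block S covers-pairs = begin
    m * (n ∸ 1 ∸ count other? S)            ≤⟨ *≤∑ per-block ⟩
    ∑[ k < m ] count (same-covering? k) S
      ≤⟨ ∑-count≤count same-covering? same? one-block (λ _ _ → proj₁) S ⟩
    count same? S                           ∎
    where
    open ≤-Reasoning
    same-covering? : ∀ k → Decidable (λ s → Same s × ∃ (Covers s k))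
    same-covering? k s = same? s ×-dec Fin.any? (covers? s k)

    one-block : ∀ s k k' → Same s × ∃ (Covers s k) → Same s × ∃ (Covers s k') → k ≡ k'
    one-block s k k' (same , j , c) (_ , j' , c') = same-one-block s k k' j j' same c c'

    split : ∀ k s → ∃ (Covers s k) → Other s ⊎ (Same s × ∃ (Covers s k))
    split k s c = [ (λ same → inj₂ (same , c)) , inj₁ ]′ (same-or-other s)

    block-bound : ∀ k → n ≤ suc (count other? S + count (same-covering? k) S)
    block-bound k = begin
      n
        ≤⟨ pairwise-covered⇒≤1+coverers (λ s → covers? s k) (λ s → covers-one s k) S (covers-pairs k) ⟩
      suc (count (λ s → Fin.any? (covers? s k)) S)             ≤⟨ s≤s (count-mono _ _ (split k) S) ⟩
      suc (count (λ s → other? s ⊎-dec same-covering? k s) S)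
        ≤⟨ s≤s (count-⊎ other? (same-covering? k) S) ⟩
      suc (count other? S + count (same-covering? k) S)        ∎

    per-block : ∀ k → n ∸ 1 ∸ count other? S ≤ count (same-covering? k) S
    per-block k = m≤n+o⇒m∸n≤o (n ∸ 1) (count other? S) (m≤n+o⇒m∸n≤o n 1 (block-bound k))

private
  one-deficient : ∀ p {a b} → b < p → suc p * (p ∸ b) ≤ a → p + p ≤ a + b
  one-deficient p {a} {b} b<p bound = begin
    p + p                   ≡⟨ cong (_+ p) (m∸n+n≡m (<⇒≤ b<p)) ⟨
    (p ∸ b + b) + p         ≡⟨ +-assoc (p ∸ b) b p ⟩
    p ∸ b + (b + p)         ≡⟨ cong (p ∸ b +_) (+-comm b p) ⟩
    p ∸ b + (p + b)         ≡⟨ +-assoc (p ∸ b) p b ⟨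
    (p ∸ b + p) + b         ≤⟨ +-monoˡ-≤ b (≤-trans (+-monoʳ-≤ (p ∸ b) (m≤m*n p (p ∸ b))) bound) ⟩
    a + b                   ∎
    where
    open ≤-Reasoning
    instance
      p∸b≢0 : NonZero (p ∸ b)
      p∸b≢0 = >-nonZero (m<n⇒0<n∸m b<p)

complementary-bounds : ∀ q {a b} → q * (q ∸ 1 ∸ b) ≤ a → q * (q ∸ 1 ∸ a) ≤ b → 2 * q ∸ 2 ≤ a + b
complementary-bounds zero    _  _  = z≤n
complementary-bounds (suc p) {a} {b} ha hb
  rewrite +-identityʳ p | +-suc p p with p ≤? b | p ≤? a
... | yes p≤b | yes p≤a = +-mono-≤ p≤a p≤b
... | no p≰b  | _       = one-deficient p (≰⇒> p≰b) ha
... | yes _   | no p≰a  = ≤-trans (one-deficient p (≰⇒> p≰a) hb) (≤-reflexive (+-comm b a))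

module _ {V : Set} {Adj : V → V → Set} where

  same-walks⇒¬DistDiffer : ∀ {s u v} →
    (∀ {n} → Walk Adj u s n → Walk Adj v s n) → (∀ {n} → Walk Adj v s n → Walk Adj u s n) →
    ¬ DistDiffer Adj s u v
  same-walks⇒¬DistDiffer u→v v→u (inj₁ (n , (wu , u-min) , ¬dv)) =
    ¬dv (u→v wu , λ m m<n wv → u-min m m<n (v→u wv))
  same-walks⇒¬DistDiffer u→v v→u (inj₂ (n , (wv , v-min) , ¬du)) =
    ¬du (v→u wv , λ m m<n wu → v-min m m<n (u→v wu))

odd : ℕ → Bool
odd zero    = false
odd (suc n) = not (odd n)

module Bipartite {V : Set} (Adj : V → V → Set) (side : V → Bool)
                 (adj-side : ∀ {u w} → Adj u w → side w ≡ not (side u))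
                 (adj-sym : ∀ {u w} → Adj u w → Adj w u) where

  walk-parity : ∀ {u v n} → Walk Adj u v n → odd n ≡ side u xor side v
  walk-parity {u} here = sym (Bool.xor-same (side u))
  walk-parity {u} {v} (step {w = w} {n = n} u~w w⇝v) = begin
    not (odd n)                    ≡⟨ cong not (walk-parity w⇝v) ⟩
    not (side w xor side v)        ≡⟨ cong (λ b → not (b xor side v)) (adj-side u~w) ⟩
    not (not (side u) xor side v)  ≡⟨ Bool.not-distribˡ-xor (not (side u)) (side v) ⟩
    not (not (side u)) xor side v  ≡⟨ cong (_xor side v) (Bool.not-involutive (side u)) ⟩
    side u xor side v              ∎
    where open ≡-Reasoning

  pad : ∀ {v s d} → ∃ (Adj v) → Walk Adj v s d → ∀ k → odd (k + d) ≡ odd d → Walk Adj v s (k + d)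
  pad _        w zero          _      = w
  pad _        _ (suc zero)    parity = contradiction (sym parity) (Bool.not-¬ refl)
  pad (_ , v~) w (suc (suc k)) parity =
    step v~ (step (adj-sym v~) (pad (_ , v~) w k (trans (sym (Bool.not-involutive _)) parity)))

  walks-transfer : ∀ {u v s d n} → side u ≡ side v → ∃ (Adj v) →
    (∀ {m} → Walk Adj u s m → d ≤ m) → Walk Adj v s d → Walk Adj u s n → Walk Adj v s n
  walks-transfer {u} {v} {s} {d} {n} same-side neighbour d≤ wv wu =
    subst (Walk Adj v s) (m∸n+n≡m (d≤ wu)) (pad neighbour wv (n ∸ d) same-parity)
    where
    open ≡-Reasoning
    same-parity : odd (n ∸ d + d) ≡ odd d
    same-parity = begin
      odd (n ∸ d + d)     ≡⟨ cong odd (m∸n+n≡m (d≤ wu)) ⟩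
      odd n               ≡⟨ walk-parity wu ⟩
      side u xor side s   ≡⟨ cong (_xor side s) same-side ⟩
      side v xor side s   ≡⟨ walk-parity wv ⟨
      odd d               ∎

module AffinePlaneProperties {q : ℕ} (A : AffinePlane q) where
  open AffinePlane A

  on? : ∀ p l → Dec (On p l)
  on? p l = inc p l Bool.≟ true

  on-irrelevant : ∀ {p l} (h h' : On p l) → h ≡ h'
  on-irrelevant = Decidable⇒UIP.≡-irrelevant Bool._≟_

  point : Line → Fin q → Point
  point l i = proj₁ (Inverse.to (order l) i)

  point-on : ∀ l i → On (point l i) l
  point-on l i = proj₂ (Inverse.to (order l) i)

  point-surjective : ∀ {p l} → On p l → ∃ λ i → point l i ≡ p
  point-surjective {p} {l} p∈l =
    Inverse.from (order l) (p , p∈l) , cong proj₁ (Inverse.strictlyInverseˡ (order l) (p , p∈l))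

  point-injective : ∀ l {i j} → point l i ≡ point l j → i ≡ j
  point-injective l {i} {j} eq = begin
    i              ≡⟨ Inverse.strictlyInverseʳ (order l) i ⟨
    from (to i)    ≡⟨ cong from (pair-≡ (to i) (to j) eq) ⟩
    from (to j)    ≡⟨ Inverse.strictlyInverseʳ (order l) j ⟩
    j              ∎
    where
    open ≡-Reasoning
    open Inverse (order l) using (to; from)
    pair-≡ : (x y : Σ Point (λ p → On p l)) → proj₁ x ≡ proj₁ y → x ≡ y
    pair-≡ (p , h) (.p , h') refl = cong (p ,_) (on-irrelevant h h')

  ≟-on : ∀ {p l} → On p l → ∀ p' → Dec (p ≡ p')
  ≟-on {p} {l} p∈l p' with on? p' l
  ... | no p'∉l  = no λ { refl → p'∉l p∈l }
  ... | yes p'∈l with point-surjective p∈l | point-surjective p'∈l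
  ... | i , refl | j , refl = Dec.map′ (cong (point l)) (point-injective l) (i ≟ j)

  meet? : ∀ l m → Dec (∃ λ p → On p l × On p m)
  meet? l m = Dec.map′ (λ (i , i∈m) → point l i , point-on l i , i∈m) index
                       (Fin.any? (λ i → on? (point l i) m))
    where
    index : (∃ λ p → On p l × On p m) → ∃ λ i → On (point l i) m
    index (p , p∈l , p∈m) with point-surjective p∈l
    ... | i , refl = i , p∈m

  point-off : ∀ l → ∃ λ p → ¬ On p l
  point-off l with noncollinear
  ... | a , b , c , ¬collinear with on? a l | on? b l | on? c l
  ... | no a∉l  | _       | _       = a , a∉l
  ... | yes _   | no b∉l  | _       = b , b∉l
  ... | yes _   | yes _   | no c∉l  = c , c∉l
  ... | yes a∈l | yes b∈l | yes c∈l = ⊥-elim (¬collinear (l , a∈l , b∈l , c∈l))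

  parallel-sym : ∀ {l m} → Parallel l m → Parallel m l
  parallel-sym (inj₁ refl) = inj₁ refl
  parallel-sym (inj₂ disj) = inj₂ (λ p (p∈m , p∈l) → disj p (p∈l , p∈m))

  parallel-unique : ∀ {l l' n p} → Parallel l n → Parallel l' n → On p l → On p l' → l ≡ l'
  parallel-unique {l} {l'} {n} {p} l∥n l'∥n p∈l p∈l' with on? p n
  ... | yes p∈n = trans (meeting⇒≡ l∥n p∈l) (sym (meeting⇒≡ l'∥n p∈l'))
    where
    meeting⇒≡ : ∀ {m} → Parallel m n → On p m → m ≡ n
    meeting⇒≡ (inj₁ m≡n)  _   = m≡n
    meeting⇒≡ (inj₂ disj) p∈m = ⊥-elim (disj p (p∈m , p∈n))
  ... | no p∉n = playfair-uniq p n p∉n l l' p∈l (off⇒disjoint l∥n p∈l) p∈l' (off⇒disjoint l'∥n p∈l')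
    where
    off⇒disjoint : ∀ {m} → Parallel m n → On p m → Disjoint m n
    off⇒disjoint (inj₁ refl) p∈m = ⊥-elim (p∉n p∈m)
    off⇒disjoint (inj₂ disj) _   = disj

  parallel-trans : ∀ {l m n} → Parallel l m → Parallel m n → Parallel l n
  parallel-trans {l} {m} {n} l∥m m∥n with meet? l n
  ... | yes (p , p∈l , p∈n) = inj₁ (parallel-unique l∥m (parallel-sym m∥n) p∈l p∈n)
  ... | no l∩n=∅            = inj₂ (λ p p∈l∩n → l∩n=∅ (p , p∈l∩n))

  distinct-parallels-disjoint : ∀ {l l' n} → Parallel l n → Parallel l' n → l ≢ l' → Disjoint l l'
  distinct-parallels-disjoint l∥n l'∥n l≢l' p (p∈l , p∈l') = l≢l' (parallel-unique l∥n l'∥n p∈l p∈l')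

  parallel-through : ∀ p l → Σ[ m ∈ Line ] On p m × Parallel m l
  parallel-through p l with on? p l
  ... | yes p∈l = l , p∈l , inj₁ refl
  ... | no p∉l with playfair p l p∉l
  ... | m , p∈m , m∩l=∅ = m , p∈m , inj₂ m∩l=∅

  meets-disjoint-partner : ∀ {l l' m c} → Disjoint l l' → On c l → On c m → m ≢ l →
                           ∃ λ c' → On c' l' × On c' m
  meets-disjoint-partner {l} {l'} {m} {c} l∩l'=∅ c∈l c∈m m≢l with meet? l' m
  ... | yes meet = meet
  ... | no ¬meet = ⊥-elim (m≢l (playfair-uniq c l' c∉l' m l c∈m m∩l'=∅ c∈l l∩l'=∅))
    where
    c∉l' : ¬ On c l'
    c∉l' c∈l' = l∩l'=∅ c (c∈l , c∈l')
    m∩l'=∅ : Disjoint m l'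
    m∩l'=∅ p (p∈m , p∈l') = ¬meet (p , p∈l' , p∈m)

module BiaffinePlaneProperties {r : ℕ} (A : AffinePlane (suc (suc r))) (ℓ₀ : AffinePlane.Line A) where
  open AffinePlane A
  open AffinePlaneProperties A
  open Biaffine A ℓ₀

  q : ℕ
  q = suc (suc r)

  point₀≢point₁ : ∀ l → point l zero ≢ point l (suc zero)
  point₀≢point₁ l eq with point-injective l eq
  ... | ()

  distinct-lines-point-off : ∀ {l m} → l ≢ m → ∃ λ p → On p l × ¬ On p m
  distinct-lines-point-off {l} {m} l≢m with on? (point l zero) m | on? (point l (suc zero)) m
  ... | no p₀∉m  | _        = _ , point-on l zero , p₀∉m
  ... | yes _    | no p₁∉m  = _ , point-on l (suc zero) , p₁∉m
  ... | yes p₀∈m | yes p₁∈m =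
    ⊥-elim (l≢m (join-uniq _ _ (point₀≢point₁ l) l m
                           (point-on l zero) (point-on l (suc zero)) p₀∈m p₁∈m))

  _≟ᴸ_ : DecidableEquality Line
  l ≟ᴸ m = Dec.map′ (λ (p₀∈l , p₁∈l) →
                       join-uniq _ _ (point₀≢point₁ m) l m p₀∈l p₁∈l p₀∈m p₁∈m)
                    (λ { refl → p₀∈m , p₁∈m })
                    (on? (point m zero) l ×-dec on? (point m (suc zero)) l)
    where
    p₀∈m : On (point m zero) m
    p₀∈m = point-on m zero
    p₁∈m : On (point m (suc zero)) m
    p₁∈m = point-on m (suc zero)

  Vertical : Line → Set
  Vertical l = Parallel l ℓ₀

  vertical : Point → Line
  vertical p = proj₁ (parallel-through p ℓ₀)

  vertical-on : ∀ p → On p (vertical p)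
  vertical-on p = proj₁ (proj₂ (parallel-through p ℓ₀))

  vertical-isVertical : ∀ p → Vertical (vertical p)
  vertical-isVertical p = proj₂ (proj₂ (parallel-through p ℓ₀))

  _≟ᴾ_ : DecidableEquality Point
  p ≟ᴾ p' = ≟-on (vertical-on p) p'

  nonvertical-meets-vertical-once : ∀ {m V a b} → ¬ Vertical m → Vertical V →
    On a m → On a V → On b m → On b V → a ≡ b
  nonvertical-meets-vertical-once {m} {V} {a} {b} ¬m↑ V↑ a∈m a∈V b∈m b∈V with a ≟ᴾ b
  ... | yes a≡b = a≡b
  ... | no a≢b  = ⊥-elim (¬m↑ (subst Vertical (sym (join-uniq a b a≢b m V a∈m b∈m a∈V b∈V)) V↑))

  nonvertical-point-off : ∀ {m V} → ¬ Vertical m → Vertical V → ∃ λ x → On x m × ¬ On x V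
  nonvertical-point-off ¬m↑ V↑ = distinct-lines-point-off λ { refl → ¬m↑ V↑ }

  joinᴮ : ∀ {V a b} → Vertical V → On a V → ¬ On b V →
          Σ[ L ∈ BLine ] On a (proj₁ L) × On b (proj₁ L)
  joinᴮ {V} {a} {b} V↑ a∈V b∉V with join a b (λ { refl → b∉V a∈V })
  ... | L , a∈L , b∈L =
    (L , λ L↑ → b∉V (subst (On b) (parallel-unique L↑ V↑ a∈L a∈V) b∈L)) , a∈L , b∈L

  line-through : ∀ p → Σ[ L ∈ BLine ] On p (proj₁ L)
  line-through p with joinᴮ (vertical-isVertical p) (vertical-on p) (proj₂ (point-off (vertical p)))
  ... | L , p∈L , _ = L , p∈L

  side : Vertex → Bool
  side (inj₁ _) = false
  side (inj₂ _) = true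

  adj-side : ∀ {u w} → Adj u w → side w ≡ not (side u)
  adj-side {inj₁ _} {inj₂ _} _ = refl
  adj-side {inj₂ _} {inj₁ _} _ = refl

  adj-sym : ∀ {u w} → Adj u w → Adj w u
  adj-sym {inj₁ _} {inj₂ _} p∈l = p∈l
  adj-sym {inj₂ _} {inj₁ _} p∈l = p∈l

  open Bipartite Adj side adj-side adj-sym

  neighbour : ∀ v → ∃ (Adj v)
  neighbour (inj₁ p) = inj₂ (proj₁ (line-through p)) , proj₂ (line-through p)
  neighbour (inj₂ l) = inj₁ (point (proj₁ l) zero) , point-on (proj₁ l) zero

  point-line-bridge : ∀ p l →
    Σ[ x ∈ Point ] Σ[ L ∈ BLine ] On x (proj₁ l) × On x (proj₁ L) × On p (proj₁ L)
  point-line-bridge p l with nonvertical-point-off (proj₂ l) (vertical-isVertical p)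
  ... | x , x∈l , x∉V with joinᴮ (vertical-isVertical p) (vertical-on p) x∉V
  ... | L , p∈L , x∈L = x , L , x∈l , x∈L , p∈L

  walk-point-line₃ : ∀ p l → Walk Adj (inj₁ p) (inj₂ l) 3
  walk-point-line₃ p l with point-line-bridge p l
  ... | x , L , x∈l , x∈L , p∈L = step {w = inj₂ L} p∈L (step {w = inj₁ x} x∈L (step x∈l here))

  walk-line-point₃ : ∀ l p → Walk Adj (inj₂ l) (inj₁ p) 3
  walk-line-point₃ l p with point-line-bridge p l
  ... | x , L , x∈l , x∈L , p∈L = step {w = inj₁ x} x∈l (step {w = inj₂ L} x∈L (step p∈L here))

  walk-point-point₄ : ∀ a b → Walk Adj (inj₁ a) (inj₁ b) 4
  walk-point-point₄ a b with line-through a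
  ... | L , a∈L = step {w = inj₂ L} a∈L (walk-line-point₃ L b)

  walk-line-line₄ : ∀ l m → Walk Adj (inj₂ l) (inj₂ m) 4
  walk-line-line₄ l m =
    step {w = inj₁ (point (proj₁ l) zero)} (point-on (proj₁ l) zero) (walk-point-line₃ _ m)

  point-line-≥3 : ∀ {a l n} → ¬ On a (proj₁ l) → Walk Adj (inj₁ a) (inj₂ l) n → 3 ≤ n
  point-line-≥3 a∉l (step a∈l here)             = ⊥-elim (a∉l a∈l)
  point-line-≥3 _   w@(step _ (step _ here))     = contradiction (walk-parity w) λ ()
  point-line-≥3 _   (step _ (step _ (step _ _))) = s≤s (s≤s (s≤s z≤n))

  line-point-≥3 : ∀ {l p n} → ¬ On p (proj₁ l) → Walk Adj (inj₂ l) (inj₁ p) n → 3 ≤ n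
  line-point-≥3 p∉l (step p∈l here)             = ⊥-elim (p∉l p∈l)
  line-point-≥3 _   w@(step _ (step _ here))     = contradiction (walk-parity w) λ ()
  line-point-≥3 _   (step _ (step _ (step _ _))) = s≤s (s≤s (s≤s z≤n))

  points-≥2 : ∀ {a p n} → a ≢ p → Walk Adj (inj₁ a) (inj₁ p) n → 2 ≤ n
  points-≥2 a≢p here                = ⊥-elim (a≢p refl)
  points-≥2 _   (step () here)
  points-≥2 _   (step _ (step _ _)) = s≤s (s≤s z≤n)

  vertical-points-≥4 : ∀ {V a p n} → Vertical V → On a V → On p V → a ≢ p →
                       Walk Adj (inj₁ a) (inj₁ p) n → 4 ≤ n
  vertical-points-≥4 _ _ _ a≢p here = ⊥-elim (a≢p refl)
  vertical-points-≥4 _ _ _ _   (step () here)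
  vertical-points-≥4 _ _ _ _   (step {w = inj₁ _} () (step _ here))
  vertical-points-≥4 V↑ a∈V p∈V a≢p (step {w = inj₂ L} a∈L (step p∈L here)) =
    ⊥-elim (a≢p (nonvertical-meets-vertical-once (proj₂ L) V↑ a∈L a∈V p∈L p∈V))
  vertical-points-≥4 _ _ _ _ w@(step _ (step _ (step _ here))) = contradiction (walk-parity w) λ ()
  vertical-points-≥4 _ _ _ _ (step _ (step _ (step _ (step _ _)))) = s≤s (s≤s (s≤s (s≤s z≤n)))

  lines-≥2 : ∀ {l m n} → proj₁ l ≢ proj₁ m → Walk Adj (inj₂ l) (inj₂ m) n → 2 ≤ n
  lines-≥2 l≢m here                = ⊥-elim (l≢m refl)
  lines-≥2 _   (step () here)
  lines-≥2 _   (step _ (step _ _)) = s≤s (s≤s z≤n)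

  disjoint-lines-≥4 : ∀ {l m n} → proj₁ l ≢ proj₁ m → Disjoint (proj₁ l) (proj₁ m) →
                      Walk Adj (inj₂ l) (inj₂ m) n → 4 ≤ n
  disjoint-lines-≥4 l≢m _ here = ⊥-elim (l≢m refl)
  disjoint-lines-≥4 _ _ (step () here)
  disjoint-lines-≥4 _ _ (step {w = inj₂ _} () (step _ here))
  disjoint-lines-≥4 _ l∩m=∅ (step {w = inj₁ c} c∈l (step c∈m here)) = ⊥-elim (l∩m=∅ c (c∈l , c∈m))
  disjoint-lines-≥4 _ _ w@(step _ (step _ (step _ here))) = contradiction (walk-parity w) λ ()
  disjoint-lines-≥4 _ _ (step _ (step _ (step _ (step _ _)))) = s≤s (s≤s (s≤s (s≤s z≤n)))

  data Twins : Vertex → Vertex → Set where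
    points : ∀ {V a b} → Vertical V → On a V → On b V → Twins (inj₁ a) (inj₁ b)
    lines  : ∀ {l m} → Disjoint (proj₁ l) (proj₁ m) → Twins (inj₂ l) (inj₂ m)

  twins-sym : ∀ {u v} → Twins u v → Twins v u
  twins-sym (points V↑ a∈V b∈V) = points V↑ b∈V a∈V
  twins-sym (lines l∩m=∅)       = lines (λ p (p∈m , p∈l) → l∩m=∅ p (p∈l , p∈m))

  -- Closed neighbourhood; lines are compared through the underlying affine line, since the proof
  -- of non-verticality carried by a BLine is not known to be unique.
  Near : Vertex → Vertex → Set
  Near (inj₁ p) (inj₁ a) = p ≡ a
  Near (inj₁ p) (inj₂ l) = On p (proj₁ l)
  Near (inj₂ m) (inj₁ a) = On a (proj₁ m)
  Near (inj₂ m) (inj₂ l) = proj₁ m ≡ proj₁ l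

  near? : ∀ s v → Dec (Near s v)
  near? (inj₁ p) (inj₁ a) = p ≟ᴾ a
  near? (inj₁ p) (inj₂ l) = on? p (proj₁ l)
  near? (inj₂ m) (inj₁ a) = on? a (proj₁ m)
  near? (inj₂ m) (inj₂ l) = proj₁ m ≟ᴸ proj₁ l

  twins-walks : ∀ {u v s n} → Twins u v → ¬ Near s u → Walk Adj u s n → Walk Adj v s n
  twins-walks {s = inj₂ l} (points V↑ a∈V b∈V) a∉l =
    walks-transfer refl (neighbour _) (point-line-≥3 a∉l) (walk-point-line₃ _ l)
  twins-walks {s = inj₁ p} (points {V} V↑ a∈V b∈V) p≢a with on? p V
  ... | yes p∈V =
    walks-transfer refl (neighbour _) (vertical-points-≥4 V↑ a∈V p∈V (≢-sym p≢a)) (walk-point-point₄ _ p)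
  ... | no p∉V with joinᴮ V↑ b∈V p∉V
  ...   | L , b∈L , p∈L =
    walks-transfer refl (neighbour _) (points-≥2 (≢-sym p≢a)) (step {w = inj₂ L} b∈L (step p∈L here))
  twins-walks {s = inj₁ p} (lines _) p∉l =
    walks-transfer refl (neighbour _) (line-point-≥3 p∉l) (walk-line-point₃ _ p)
  twins-walks {s = inj₂ m} (lines {l} l∩l'=∅) m≢l with meet? (proj₁ l) (proj₁ m)
  ... | no ¬meet =
    walks-transfer refl (neighbour _) (disjoint-lines-≥4 (≢-sym m≢l) (λ c c∈l∩m → ¬meet (c , c∈l∩m)))
                   (walk-line-line₄ _ m)
  ... | yes (c , c∈l , c∈m) with meets-disjoint-partner l∩l'=∅ c∈l c∈m m≢l
  ...   | c' , c'∈l' , c'∈m =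
    walks-transfer refl (neighbour _) (lines-≥2 (≢-sym m≢l)) (step {w = inj₁ c'} c'∈l' (step c'∈m here))

  twins-unresolved : ∀ {u v s} → Twins u v → ¬ Near s u → ¬ Near s v → ¬ DistDiffer Adj s u v
  twins-unresolved t ¬near-u ¬near-v =
    same-walks⇒¬DistDiffer (twins-walks t ¬near-u) (twins-walks (twins-sym t) ¬near-v)

  resolving⇒twins-near : ∀ {S u v} → IsResolving S → Twins u v → u ≢ v →
                         Any (λ s → Near s u ⊎ Near s v) S
  resolving⇒twins-near {S} {u} {v} resolving t u≢v = Any.map near-one (resolving u v u≢v)
    where
    near-one : ∀ {s} → DistDiffer Adj s u v → Near s u ⊎ Near s v
    near-one {s} differ with near? s u | near? s v
    ... | yes near-u | _          = inj₁ near-u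
    ... | no _       | yes near-v = inj₂ near-v
    ... | no ¬near-u | no ¬near-v = ⊥-elim (twins-unresolved t ¬near-u ¬near-v differ)

  IsPoint IsLine : Vertex → Set
  IsPoint (inj₁ _) = ⊤
  IsPoint (inj₂ _) = ⊥
  IsLine  (inj₁ _) = ⊥
  IsLine  (inj₂ _) = ⊤

  isPoint? : Decidable IsPoint
  isPoint? (inj₁ _) = yes tt
  isPoint? (inj₂ _) = no λ ()

  isLine? : Decidable IsLine
  isLine? (inj₁ _) = no λ ()
  isLine? (inj₂ _) = yes tt

  point-or-line : ∀ v → IsPoint v ⊎ IsLine v
  point-or-line (inj₁ _) = inj₁ tt
  point-or-line (inj₂ _) = inj₂ tt

  point-and-line : ∀ v → ¬ (IsPoint v × IsLine v)
  point-and-line (inj₁ _) (_ , ())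
  point-and-line (inj₂ _) (() , _)

  private
    M : BLine
    M = proj₁ (line-through (point ℓ₀ zero))

  column : Fin q → Line
  column k = vertical (point (proj₁ M) k)

  column-point : Fin q → Fin q → Point
  column-point k j = point (column k) j

  column-unique : ∀ {p k k'} → On p (column k) → On p (column k') → k ≡ k'
  column-unique {p} {k} {k'} p∈k p∈k' =
    point-injective (proj₁ M)
      (nonvertical-meets-vertical-once (proj₂ M) (vertical-isVertical _)
         (point-on (proj₁ M) k) (vertical-on _)
         (point-on (proj₁ M) k') (subst (On _) (sym same-column) (vertical-on _)))
    where
    same-column : column k ≡ column k'
    same-column = parallel-unique (vertical-isVertical _) (vertical-isVertical _) p∈k p∈k'

  points-bound : ∀ {S} → IsResolving S → q * (q ∸ 1 ∸ count isLine? S) ≤ count isPoint? S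
  points-bound {S} resolving =
    blocks-covered⇒bound isPoint? isLine? point-or-line
                         (λ s k j → near? s (inj₁ (column-point k j)))
                         covers-one same-one-block S covers-pairs
    where
    covers-one : ∀ s k j j' →
      Near s (inj₁ (column-point k j)) → Near s (inj₁ (column-point k j')) → j ≡ j'
    covers-one (inj₁ p) k j j' refl eq  = point-injective _ eq
    covers-one (inj₂ l) k j j' j∈l j'∈l =
      point-injective _ (nonvertical-meets-vertical-once (proj₂ l) (vertical-isVertical _)
                                                         j∈l (point-on _ j) j'∈l (point-on _ j'))

    same-one-block : ∀ s k k' j j' → IsPoint s →
      Near s (inj₁ (column-point k j)) → Near s (inj₁ (column-point k' j')) → k ≡ k'
    same-one-block (inj₁ p) k k' j j' _ refl eq =
      column-unique (point-on _ j) (subst (λ x → On x (column k')) (sym eq) (point-on _ j'))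

    covers-pairs : ∀ k j j' → j ≢ j' →
      Any (λ s → Near s (inj₁ (column-point k j)) ⊎ Near s (inj₁ (column-point k j'))) S
    covers-pairs k j j' j≢j' =
      resolving⇒twins-near resolving (points (vertical-isVertical _) (point-on _ j) (point-on _ j'))
                                     (j≢j' ∘ point-injective _ ∘ inj₁-injective)

  private
    o : Point
    o = proj₁ (point-off ℓ₀)

    through-o : ∀ k → Σ[ L ∈ BLine ] On (point ℓ₀ k) (proj₁ L) × On o (proj₁ L)
    through-o k = joinᴮ (inj₁ refl) (point-on ℓ₀ k) (proj₂ (point-off ℓ₀))

  direction : Fin q → BLine
  direction k = proj₁ (through-o k)

  direction-on : ∀ k → On (point ℓ₀ k) (proj₁ (direction k))
  direction-on k = proj₁ (proj₂ (through-o k))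

  o-on-direction : ∀ k → On o (proj₁ (direction k))
  o-on-direction k = proj₂ (proj₂ (through-o k))

  direction-line : Fin q → Fin q → Line
  direction-line k j = proj₁ (parallel-through (point ℓ₀ j) (proj₁ (direction k)))

  direction-line-on : ∀ k j → On (point ℓ₀ j) (direction-line k j)
  direction-line-on k j = proj₁ (proj₂ (parallel-through (point ℓ₀ j) (proj₁ (direction k))))

  direction-line-parallel : ∀ k j → Parallel (direction-line k j) (proj₁ (direction k))
  direction-line-parallel k j = proj₂ (proj₂ (parallel-through (point ℓ₀ j) (proj₁ (direction k))))

  direction-lineᴮ : Fin q → Fin q → BLine
  direction-lineᴮ k j = direction-line k j , λ L↑ →
    proj₂ (direction k) (parallel-trans (parallel-sym (direction-line-parallel k j)) L↑)

  direction-line-injective : ∀ {k j j'} → direction-line k j ≡ direction-line k j' → j ≡ j'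
  direction-line-injective {k} {j} {j'} eq =
    point-injective ℓ₀
      (nonvertical-meets-vertical-once (proj₂ (direction-lineᴮ k j)) (inj₁ refl)
         (direction-line-on k j) (point-on ℓ₀ j)
         (subst (On _) (sym eq) (direction-line-on k j')) (point-on ℓ₀ j'))

  direction-line-unique : ∀ {k k' j j'} → direction-line k j ≡ direction-line k' j' → k ≡ k'
  direction-line-unique {k} {k'} {j} {j'} eq =
    point-injective ℓ₀
      (nonvertical-meets-vertical-once (proj₂ (direction k)) (inj₁ refl)
         (direction-on k) (point-on ℓ₀ k)
         (subst (On _) (sym same-direction) (direction-on k')) (point-on ℓ₀ k'))
    where
    k∥k' : Parallel (proj₁ (direction k)) (proj₁ (direction k'))
    k∥k' = parallel-trans (parallel-sym (direction-line-parallel k j))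
                          (subst (λ L → Parallel L _) (sym eq) (direction-line-parallel k' j'))
    same-direction : proj₁ (direction k) ≡ proj₁ (direction k')
    same-direction = parallel-unique k∥k' (inj₁ refl) (o-on-direction k) (o-on-direction k')

  lines-bound : ∀ {S} → IsResolving S → q * (q ∸ 1 ∸ count isPoint? S) ≤ count isLine? S
  lines-bound {S} resolving =
    blocks-covered⇒bound isLine? isPoint? (swap ∘ point-or-line)
                         (λ s k j → near? s (inj₂ (direction-lineᴮ k j)))
                         covers-one same-one-block S covers-pairs
    where
    covers-one : ∀ s k j j' →
      Near s (inj₂ (direction-lineᴮ k j)) → Near s (inj₂ (direction-lineᴮ k j')) → j ≡ j'
    covers-one (inj₁ p) k j j' p∈j p∈j' = direction-line-injective
      (parallel-unique (direction-line-parallel k j) (direction-line-parallel k j') p∈j p∈j')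
    covers-one (inj₂ m) k j j' eq eq'   = direction-line-injective (trans (sym eq) eq')

    same-one-block : ∀ s k k' j j' → IsLine s →
      Near s (inj₂ (direction-lineᴮ k j)) → Near s (inj₂ (direction-lineᴮ k' j')) → k ≡ k'
    same-one-block (inj₂ m) k k' j j' _ eq eq' = direction-line-unique (trans (sym eq) eq')

    covers-pairs : ∀ k j j' → j ≢ j' →
      Any (λ s → Near s (inj₂ (direction-lineᴮ k j)) ⊎ Near s (inj₂ (direction-lineᴮ k j'))) S
    covers-pairs k j j' j≢j' =
      resolving⇒twins-near resolving
        (lines (distinct-parallels-disjoint (direction-line-parallel k j) (direction-line-parallel k j')
                                            (j≢j' ∘ direction-line-injective)))
        (j≢j' ∘ direction-line-injective ∘ cong proj₁ ∘ inj₂-injective)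

mainTheorem4 : (q : ℕ) (A : AffinePlane q) (ℓ₀ : AffinePlane.Line A)
    (S : List (Biaffine.Vertex A ℓ₀)) →
    Unique S → Biaffine.IsResolving A ℓ₀ S → 2 * q ∸ 2 ≤ length S
mainTheorem4 zero          _ _  _ _ _         = z≤n
mainTheorem4 (suc zero)    _ _  _ _ _         = z≤n
mainTheorem4 (suc (suc r)) A ℓ₀ S _ resolving = begin
  2 * q ∸ 2
    ≤⟨ complementary-bounds q (points-bound resolving) (lines-bound resolving) ⟩
  count isPoint? S + count isLine? S
    ≤⟨ count+count≤length isPoint? isLine? point-and-line S ⟩
  length S
    ∎
  where
  open ≤-Reasoning
  open BiaffinePlaneProperties A ℓ₀
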